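{- Let $m,k$ be positive integers and let $M:(\mathbb{Z}^m)^k\to(\mathbb{Z}^m)^k$ be an invariant group homomorphism (i.e. $M(x,\dots,x)=0$ for all $x\in\mathbb{Z}^m$), given by an integer matrix. For $n\ge1$ let $S_n=M^{ -1}(0)\cap([1,n]^m)^k$, and assume the sequence of systems $\{(S_n,[1,n]^m)\}_{n\ge1}$ satisfies the V-property with a function $\gamma$ depending only on $M$ (the same for all $n$). For a positive integer $N$ let $M_N:(\mathbb{Z}_N^m)^k\to(\mathbb{Z}_N^m)^k$ be the homomorphism given by the same integer matrix reduced modulo $N$, and $\overline{S}_N=M_N^{ -1}(0)$. Then there exist a positive integer $\lambda$ and a constant $c>0$, both depending only on $M$, such that for every $n$ and every $j\in[1,k]$, $$\alpha_j(S_n,[1,n]^m)\ \le\ \alpha_j(\overline{S}_{\lambda n},\mathbb{Z}_{\lambda n}^m)\ \le\ c\,\alpha_j(S_n,[1,n]^m).$$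
   Context: $\mathbb{Z}_N=\mathbb{Z}/N\mathbb{Z}$, and $[1,n]^m$ is regarded inside $\mathbb{Z}_{\lambda n}^m$ in the natural way. For a finite set $G$ and $S\subseteq G^k$, and $U=\{u_1<\dots<u_r\}\subseteq[1,k]$, $\pi_U(g_1,\dots,g_k)=(g_{u_1},\dots,g_{u_r})$; the $j$-th degree of freedom is $\alpha_j(S,G)=\max_{U\subseteq[1,k],|U|=j}\max_{(g_1,\dots,g_j)\in G^j}|S\cap\pi_U^{ -1}(g_1,\dots,g_j)|$. A sequence $(S_n,G_n)$ satisfies the V-property with function $\gamma$ if for every $\varepsilon>0$ there is $\gamma(\varepsilon)>0$ such that for all $n$, every $X\subseteq G_n$ with $|X|\ge\varepsilon|G_n|$ has $|X^k\cap S_n|\ge\gamma(\varepsilon)|S_n|$. -}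

module Defs where

open import Data.Bool using (Bool; true; false; _∧_; _∨_; not; if_then_else_)
open import Data.Nat as ℕ using (ℕ; zero; suc; _⊔_; _^_)
open import Data.Nat.Divisibility using (_∣?_)
open import Data.Fin as Fin using (Fin; toℕ)
open import Data.Integer as ℤ using (ℤ; +_; ∣_∣)
open import Data.List using (List; []; _∷_; map; concatMap; foldr; allFin)
open import Data.Rational as ℚ using (ℚ; 0ℚ)
open import Relation.Nullary.Decidable using (⌊_⌋)
open import Relation.Binary.PropositionalEquality using (_≡_)
open import Data.Product using (_×_)

cons : ∀ {A : Set} {n : ℕ} → A → (Fin n → A) → Fin (suc n) → A
cons x f Fin.zero = x
cons x f (Fin.suc i) = f i

allFuns : ∀ {A : Set} (n : ℕ) → List A → List (Fin n → A)
allFuns zero xs = (λ ()) ∷ []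
allFuns (suc n) xs = concatMap (λ x → map (cons x) (allFuns n xs)) xs

count : ∀ {A : Set} → (A → Bool) → List A → ℕ
count p = foldr (λ x r → if p x then suc r else r) 0

maxList : List ℕ → ℕ
maxList = foldr _⊔_ 0

allᶠ : (n : ℕ) → (Fin n → Bool) → Bool
allᶠ n p = foldr (λ i r → p i ∧ r) true (allFin n)

∑ : (n : ℕ) → (Fin n → ℤ) → ℤ
∑ zero f = + 0
∑ (suc n) f = f Fin.zero ℤ.+ ∑ n (λ i → f (Fin.suc i))

toℚ : ℕ → ℚ
toℚ n = + n ℚ./ 1

-- Degrees of freedom α_j(S, G) for S ⊆ G^k, G finite (enumerated by
-- `elems`, with Boolean equality `eqG`), S given by a Boolean predicate.
-- The fibre π_U^{-1}(g), g ∈ G^j, is written as {s | s_u = h_u ∀ u ∈ U}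
-- for h ∈ G^k (only the coordinates of h in U matter).

size : {k : ℕ} → (Fin k → Bool) → ℕ
size {k} U = count U (allFin k)

alpha : {G : Set} (k : ℕ) (elems : List G) (eqG : G → G → Bool)
        (S : (Fin k → G) → Bool) (j : ℕ) → ℕ
alpha {G} k elems eqG S j =
  maxList (concatMap
    (λ U → if ⌊ size U ℕ.≟ j ⌋
           then map (λ h → count (λ s → S s ∧ agree U h s) tuples) tuples
           else [])
    (allFuns k (true ∷ false ∷ [])))
  where
  tuples : List (Fin k → G)
  tuples = allFuns k elems
  agree : (Fin k → Bool) → (Fin k → G) → (Fin k → G) → Bool
  agree U h s = allᶠ k (λ i → not (U i) ∨ eqG (h i) (s i))

-- Integer matrices acting on (ℤ^m)^k.  An element of (ℤ^m)^k is a
-- function Fin k → Fin m → ℤ; the matrix has entry M i a i' a' in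
-- row (i,a), column (i',a').

Mat : ℕ → ℕ → Set
Mat m k = Fin k → Fin m → Fin k → Fin m → ℤ

apply : {m k : ℕ} → Mat m k → (Fin k → Fin m → ℤ) → Fin k → Fin m → ℤ
apply {m} {k} M x i a = ∑ k (λ i' → ∑ m (λ a' → M i a i' a' ℤ.* x i' a'))

Invariant : {m k : ℕ} → Mat m k → Set
Invariant {m} {k} M = ∀ (x : Fin m → ℤ) i a → apply M (λ _ → x) i a ≡ + 0

-- The box [1,n]^m: an element is v : Fin m → Fin n, standing for the
-- integer vector a ↦ toℕ (v a) + 1.

Box : ℕ → ℕ → Set
Box m n = Fin m → Fin n

boxElems : (m n : ℕ) → List (Box m n)
boxElems m n = allFuns m (allFin n)

eqVec : {m n : ℕ} → (Fin m → Fin n) → (Fin m → Fin n) → Bool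
eqVec {m} g g' = allᶠ m (λ a → ⌊ g a Fin.≟ g' a ⌋)

boxToℤ : {m n : ℕ} → Box m n → Fin m → ℤ
boxToℤ v a = + suc (toℕ (v a))

inS : {m k : ℕ} → Mat m k → (n : ℕ) → (Fin k → Box m n) → Bool
inS {m} {k} M n x =
  allᶠ k (λ i → allᶠ m (λ a → ⌊ apply M (λ i' → boxToℤ (x i')) i a ℤ.≟ + 0 ⌋))

αbox : {m k : ℕ} → Mat m k → (n j : ℕ) → ℕ
αbox {m} {k} M n j = alpha k (boxElems m n) eqVec (inS M n) j

-- ℤ_N^m: an element is v : Fin m → Fin N (residues 0..N-1).
-- \bar S_N = M_N^{-1}(0): reduction mod N commutes with the matrix, so
-- x ∈ \bar S_N iff N divides every coordinate of M applied to a lift of x.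

inSbar : {m k : ℕ} → Mat m k → (N : ℕ) → (Fin k → Fin m → Fin N) → Bool
inSbar {m} {k} M N x =
  allᶠ k (λ i → allᶠ m (λ a →
    ⌊ N ∣? ∣ apply M (λ i' a' → + toℕ (x i' a')) i a ∣ ⌋))

αbar : {m k : ℕ} → Mat m k → (N j : ℕ) → ℕ
αbar {m} {k} M N j = alpha k (boxElems m N) eqVec (inSbar M N) j

VProperty : {m k : ℕ} → Mat m k → (ℚ → ℚ) → Set
VProperty {m} {k} M γ =
  ∀ (ε : ℚ) → 0ℚ ℚ.< ε →
    (0ℚ ℚ.< γ ε) ×
    (∀ (n : ℕ) → 1 ℕ.≤ n → (X : Box m n → Bool) →
       ε ℚ.* toℚ (n ^ m) ℚ.≤ toℚ (count X (boxElems m n)) →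
       γ ε ℚ.* toℚ (count (inS M n) (allFuns k (boxElems m n)))
         ℚ.≤ toℚ (count (λ s → inS M n s ∧ allᶠ k (λ i → X (s i)))
                        (allFuns k (boxElems m n))))

-- Work with tuples x ∈ ([0,n)^m)^k, read either as residues mod n or, shifted by one, as points of
-- the box [1,n]^m.  Invariance of M makes the shift irrelevant to M x, so S_n ⊆ S̄_n and λ = 1 gives
-- the first inequality.  For the second, sort the points of a fibre of S̄_n into classes by the vector
-- M x / n, whose entries are bounded in terms of M alone, and by the half of [0,n) in which each
-- coordinate of x lies.  For a fixed r in a class, x ↦ x − r + ⌊n/2⌋ stays inside [0,n), is injective
-- on the class, and (as M x = M r) maps it into the fibre of S_n over the constant tuple ⌊n/2⌋.
-- So every fibre of S̄_n is at most (number of classes) times a fibre of S_n.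

module Submission where

open import Defs

open import Data.Bool as Bool using (Bool; true; false; T; _∧_; _∨_; not; if_then_else_)
open import Data.Bool.Properties using (T-∧)
open import Data.Empty using (⊥-elim)
open import Data.Fin as Fin using (Fin; toℕ)
import Data.Fin.Properties as Finₚ
open import Data.Integer as ℤ using (ℤ; +_; ∣_∣; sign; _◃_)
import Data.Integer.Properties as ℤₚ
open import Algebra.Properties.AbelianGroup ℤₚ.+-0-abelianGroup using (identityˡ-unique)
open import Algebra.Properties.CommutativeSemigroup ℤₚ.+-commutativeSemigroup using ()
  renaming (interchange to +-interchange)
open import Data.List using (List; []; _∷_; map; length; filterᵇ; allFin; cartesianProduct; upTo)
import Data.List.Properties as Listₚ
open import Data.List.Membership.Propositional using (_∈_; find)
import Data.List.Membership.Propositional.Properties as Memₚ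
open import Data.List.Relation.Binary.Disjoint.Setoid using (Disjoint)
open import Data.List.Relation.Unary.All as All using (All; []; _∷_)
import Data.List.Relation.Unary.All.Properties as Allₚ
import Data.List.Relation.Unary.AllPairs as AllPairs
import Data.List.Relation.Unary.AllPairs.Properties as AllPairsₚ
open import Data.List.Relation.Unary.Any as Any using (Any; here; there; _─_)
import Data.List.Relation.Unary.Any.Properties as Anyₚ
open import Data.List.Relation.Unary.Unique.Setoid using (Unique)
import Data.List.Relation.Unary.Unique.Setoid.Properties as Uniqueₚ
open import Data.List.Relation.Unary.Unique.Propositional.Properties using (allFin⁺)
open import Data.Nat as ℕ using (ℕ; zero; suc; _+_; _*_; _∸_; _≤_; _<_; _<?_; _⊔_; z≤n; s≤s; NonZero; ⌊_/2⌋; ⌈_/2⌉)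
import Data.Nat.Coprimality as Coprimality
open import Data.Nat.Divisibility using (_∣_; _∣0)
open import Data.Nat.DivMod using (_/_; _mod_; m/n*n≡m; m*n/n≡m; m<n⇒m%n≡m; /-monoˡ-≤)
open import Data.Nat.ListAction using (sum)
import Data.Nat.Properties as ℕₚ
open import Data.Product using (Σ; ∃; _×_; _,_; proj₁; proj₂)
open import Data.Product.Properties using () renaming (≡-dec to ×-≡-dec)
open import Data.Rational as ℚ using (ℚ; 0ℚ; mkℚ)
import Data.Rational.Properties as ℚₚ
open import Data.Sign as Sign using (Sign)
open import Data.Sum using (_⊎_; inj₁; inj₂)
open import Data.Unit using (tt)
import Data.Vec.Functional.Relation.Binary.Pointwise.Properties as Pointwiseₚ
open import Function using (_∘_)
open import Function.Bundles using (Equivalence)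
open import Level using (0ℓ)
open import Relation.Binary using (Setoid; Rel; Decidable)
open import Relation.Binary.PropositionalEquality as ≡ using (_≡_; refl; cong; subst; subst₂)
open import Relation.Nullary using (¬_; yes; no)
open import Relation.Nullary.Decidable using (⌊_⌋; T?; toWitness; fromWitness)

private variable
  A C : Set

allᶠ⁻ : ∀ n {p : Fin n → Bool} → T (allᶠ n p) → ∀ i → T (p i)
allᶠ⁻ n {p} t = Allₚ.tabulate⁻ (Allₚ.all⁺ p (allFin n) (subst T (≡.sym (Listₚ.foldr-map _∧_ p true (allFin n))) t))

allᶠ⁺ : ∀ n {p : Fin n → Bool} → (∀ i → T (p i)) → T (allᶠ n p)
allᶠ⁺ n {p} h = subst T (Listₚ.foldr-map _∧_ p true (allFin n)) (Allₚ.all⁻ p (Allₚ.tabulate⁺ h))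

T-∧⁻ : ∀ {a b} → T (a ∧ b) → T a × T b
T-∧⁻ = Equivalence.to T-∧

T-∧⁺ : ∀ {a b} → T a → T b → T (a ∧ b)
T-∧⁺ ta tb = Equivalence.from T-∧ (ta , tb)

count≡length-filterᵇ : ∀ (p : A → Bool) xs → count p xs ≡ length (filterᵇ p xs)
count≡length-filterᵇ p [] = refl
count≡length-filterᵇ p (x ∷ xs) with p x
... | true = cong suc (count≡length-filterᵇ p xs)
... | false = count≡length-filterᵇ p xs

count-mono : ∀ {p q : A → Bool} xs → (∀ {x} → x ∈ xs → T (p x) → T (q x)) → count p xs ≤ count q xs
count-mono [] h = z≤n
count-mono {p = p} {q} (x ∷ xs) h with p x in px | q x in qx
... | true | true = s≤s (count-mono xs (h ∘ there))
... | false | true = ℕₚ.m≤n⇒m≤1+n (count-mono xs (h ∘ there))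
... | false | false = count-mono xs (h ∘ there)
... | true | false = ⊥-elim (subst T qx (h (here refl) (subst T (≡.sym px) tt)))

count-≤-if-witnessed : ∀ (p : A → Bool) xs {b} → (∀ {r} → r ∈ xs → T (p r) → count p xs ≤ b) → count p xs ≤ b
count-≤-if-witnessed p [] h = z≤n
count-≤-if-witnessed p (x ∷ xs) h with p x in px
... | true = h (here refl) (subst T (≡.sym px) tt)
... | false = count-≤-if-witnessed p xs (h ∘ there)

sum-map-mono : ∀ {f g : C → ℕ} cs → (∀ c → f c ≤ g c) → sum (map f cs) ≤ sum (map g cs)
sum-map-mono [] h = z≤n
sum-map-mono (c ∷ cs) h = ℕₚ.+-mono-≤ (h c) (sum-map-mono cs h)

sum-map-< : ∀ {f g : C → ℕ} {cs} → (∀ c → f c ≤ g c) → Any (λ c → f c < g c) cs → sum (map f cs) < sum (map g cs)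
sum-map-< {cs = c ∷ cs} h (here lt) = ℕₚ.+-mono-<-≤ lt (sum-map-mono cs h)
sum-map-< {cs = c ∷ cs} h (there a) = ℕₚ.+-mono-≤-< (h c) (sum-map-< h a)

sum-map-≤ : ∀ {f : C → ℕ} {b} cs → (∀ c → f c ≤ b) → sum (map f cs) ≤ length cs * b
sum-map-≤ [] h = z≤n
sum-map-≤ (c ∷ cs) h = ℕₚ.+-mono-≤ (h c) (sum-map-≤ cs h)

module _ (p : A → Bool) (P : C → A → Bool) where

  classCount : List A → C → ℕ
  classCount xs c = count (λ x → p x ∧ P c x) xs

  count-≤-sum-classCount : ∀ cs xs → (∀ {x} → x ∈ xs → T (p x) → Any (λ c → T (P c x)) cs) →
    count p xs ≤ sum (map (classCount xs) cs)
  count-≤-sum-classCount cs [] h = z≤n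
  count-≤-sum-classCount cs (x ∷ xs) h with p x in px
  ... | false = count-≤-sum-classCount cs xs (h ∘ there)
  ... | true = ℕₚ.≤-trans (s≤s (count-≤-sum-classCount cs xs (h ∘ there)))
                          (sum-grows cs (h (here refl) (subst T (≡.sym px) tt)))
    where
    classCount′ : C → ℕ
    classCount′ c = if P c x then suc (classCount xs c) else classCount xs c
    grows : ∀ c → classCount xs c ≤ classCount′ c
    grows c with P c x
    ... | true = ℕₚ.n≤1+n _
    ... | false = ℕₚ.≤-refl
    grows-strictly : ∀ {c} → T (P c x) → classCount xs c < classCount′ c
    grows-strictly {c} t with P c x
    ... | true = ℕₚ.≤-refl
    sum-grows : ∀ cs → Any (λ c → T (P c x)) cs → suc (sum (map (classCount xs) cs)) ≤ sum (map classCount′ cs)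
    sum-grows cs = sum-map-< grows ∘ Any.map grows-strictly

count-≤-partition : ∀ {_∼_ : Rel C 0ℓ} (_≟_ : Decidable _∼_) (cl : A → C) (p : A → Bool) cs xs {b} →
  (∀ {x} → x ∈ xs → T (p x) → Any (cl x ∼_) cs) →
  (∀ c → count (λ x → p x ∧ ⌊ cl x ≟ c ⌋) xs ≤ b) →
  count p xs ≤ length cs * b
count-≤-partition _≟_ cl p cs xs cover bound = ℕₚ.≤-trans
  (count-≤-sum-classCount p (λ c x → ⌊ cl x ≟ c ⌋) cs xs (λ x∈ px → Any.map fromWitness (cover x∈ px)))
  (sum-map-≤ cs bound)

any-filterᵇ : ∀ {P : A → Set} (q : A → Bool) {xs} → Any (λ y → P y × T (q y)) xs → Any P (filterᵇ q xs)
any-filterᵇ q {y ∷ xs} (here (py , qy)) with q y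
... | true = here py
any-filterᵇ q {y ∷ xs} (there a) with q y
... | true = there (any-filterᵇ q a)
... | false = any-filterᵇ q a

module _ (S₁ S₂ : Setoid 0ℓ 0ℓ) where
  open Setoid S₁ using () renaming (Carrier to A₁; _≈_ to _≈₁_)
  open Setoid S₂ using () renaming (Carrier to A₂; _≈_ to _≈₂_)
  open import Data.List.Membership.Setoid S₂ using () renaming (_∈_ to _∈₂_)

  ∈-─⁺ : ∀ {v w ys} (w∈ : w ∈₂ ys) → v ∈₂ ys → ¬ v ≈₂ w → v ∈₂ (ys ─ w∈)
  ∈-─⁺ (here w≈) (here v≈) v≉w = ⊥-elim (v≉w (Setoid.trans S₂ v≈ (Setoid.sym S₂ w≈)))
  ∈-─⁺ (here _) (there v∈) _ = v∈
  ∈-─⁺ (there _) (here v≈) _ = here v≈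
  ∈-─⁺ (there w∈) (there v∈) v≉w = there (∈-─⁺ w∈ v∈ v≉w)

  length-≤-injection : (f : A₁ → A₂) {xs : List A₁} {ys : List A₂} → Unique S₁ xs →
    (∀ {x} → x ∈ xs → f x ∈₂ ys) →
    (∀ {x y} → x ∈ xs → y ∈ xs → f x ≈₂ f y → x ≈₁ y) →
    length xs ≤ length ys
  length-≤-injection f {[]} _ _ _ = z≤n
  length-≤-injection f {x ∷ xs} {ys} (x≉xs AllPairs.∷ unique) into inj =
    subst (suc (length xs) ≤_) (≡.sym (Listₚ.length-removeAt′ ys (Any.index fx∈)))
      (s≤s (length-≤-injection f unique into′ (λ x∈ y∈ → inj (there x∈) (there y∈))))
    where
    fx∈ : f x ∈₂ ys
    fx∈ = into (here refl)
    into′ : ∀ {y} → y ∈ xs → f y ∈₂ (ys ─ fx∈)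
    into′ {y} y∈ = ∈-─⁺ fx∈ (into (there y∈))
      (λ fy≈fx → All.lookup x≉xs y∈ (inj (here refl) (there y∈) (Setoid.sym S₂ fy≈fx)))

  count-≤-injection : (f : A₁ → A₂) (p : A₁ → Bool) (q : A₂ → Bool) → ∀ {xs ys} → Unique S₁ xs →
    (∀ {x} → x ∈ xs → T (p x) → Any (λ y → f x ≈₂ y × T (q y)) ys) →
    (∀ {x y} → x ∈ xs → y ∈ xs → T (p x) → T (p y) → f x ≈₂ f y → x ≈₁ y) →
    count p xs ≤ count q ys
  count-≤-injection f p q {xs} {ys} unique into inj =
    subst₂ _≤_ (≡.sym (count≡length-filterᵇ p xs)) (≡.sym (count≡length-filterᵇ q ys))
      (length-≤-injection f (Uniqueₚ.filter⁺ S₁ (T? ∘ p) unique)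
        (λ x∈ → let x∈xs , px = filter⁻ x∈ in any-filterᵇ q (into x∈xs px))
        (λ x∈ y∈ → let x∈xs , px = filter⁻ x∈ ; y∈xs , py = filter⁻ y∈ in inj x∈xs y∈xs px py))
    where
    filter⁻ : ∀ {x} → x ∈ filterᵇ p xs → x ∈ xs × T (p x)
    filter⁻ = Memₚ.∈-filter⁻ (T? ∘ p)

maxList-ub : ∀ {x} xs → x ∈ xs → x ≤ maxList xs
maxList-ub (y ∷ xs) (here refl) = ℕₚ.m≤m⊔n y (maxList xs)
maxList-ub (y ∷ xs) (there x∈) = ℕₚ.≤-trans (maxList-ub xs x∈) (ℕₚ.m≤n⊔m y (maxList xs))

maxList-lub : ∀ {b} xs → All (_≤ b) xs → maxList xs ≤ b
maxList-lub [] [] = z≤n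
maxList-lub (x ∷ xs) (x≤ ∷ xs≤) = ℕₚ.⊔-lub x≤ (maxList-lub xs xs≤)

module _ (S : Setoid 0ℓ 0ℓ) where
  open Setoid S
  open import Data.List.Membership.Setoid S using () renaming (_∈_ to _∈ₛ_)

  Funs : ℕ → Setoid 0ℓ 0ℓ
  Funs = Pointwiseₚ.setoid S

  allFuns-complete : ∀ n {xs} (f : Fin n → Carrier) → (∀ i → f i ∈ₛ xs) →
    Any (Setoid._≈_ (Funs n) f) (allFuns n xs)
  allFuns-complete zero f _ = here (λ ())
  allFuns-complete (suc n) f f∈ = Anyₚ.concat⁺ (Anyₚ.map⁺ (Any.map extend (f∈ Fin.zero)))
    where
    extend : ∀ {x} → f Fin.zero ≈ x → Any (Setoid._≈_ (Funs (suc n)) f) (map (cons x) (allFuns n _))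
    extend f₀≈x = Anyₚ.map⁺ (Any.map (λ { f′≈g Fin.zero → f₀≈x ; f′≈g (Fin.suc i) → f′≈g i })
                                      (allFuns-complete n (f ∘ Fin.suc) (f∈ ∘ Fin.suc)))

  allFuns-unique : ∀ n {xs} → Unique S xs → Unique (Funs n) (allFuns n xs)
  allFuns-unique zero _ = [] AllPairs.∷ AllPairs.[]
  allFuns-unique (suc n) {xs} xs! = Uniqueₚ.concat⁺ (Funs (suc n))
    (Allₚ.map⁺ (All.universal (λ x → Uniqueₚ.map⁺ (Funs n) (Funs (suc n)) (λ e → e ∘ Fin.suc) (allFuns-unique n xs!)) xs))
    (AllPairsₚ.map⁺ (AllPairs.map disjoint xs!))
    where
    L : List (Fin n → Carrier)
    L = allFuns n xs
    head≈ : ∀ {x v} → Any (Setoid._≈_ (Funs (suc n)) v) (map (cons x) L) → v Fin.zero ≈ x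
    head≈ v∈ = proj₂ (Any.satisfied (Anyₚ.map⁻ v∈)) Fin.zero
    disjoint : ∀ {x y} → ¬ x ≈ y → Disjoint (Funs (suc n)) (map (cons x) L) (map (cons y) L)
    disjoint x≉y (v∈x , v∈y) = x≉y (trans (sym (head≈ v∈x)) (head≈ v∈y))

agrees : ∀ {G : Set} {k} → (G → G → Bool) → (Fin k → Bool) → (Fin k → G) → (Fin k → G) → Bool
agrees {k = k} eqG U h s = allᶠ k (λ i → not (U i) ∨ eqG (h i) (s i))

module _ {G : Set} (k : ℕ) (elems : List G) (eqG : G → G → Bool) where

  fibreSize : ((Fin k → G) → Bool) → (Fin k → Bool) → (Fin k → G) → ℕ
  fibreSize S U h = count (λ s → S s ∧ agrees eqG U h s) (allFuns k elems)

  fibreSize-≤-alpha : ∀ S j {U h} → U ∈ allFuns k (true ∷ false ∷ []) → size U ≡ j → h ∈ allFuns k elems →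
    fibreSize S U h ≤ alpha k elems eqG S j
  fibreSize-≤-alpha S j {U} {h} U∈ e h∈ = maxList-ub _ (Anyₚ.concat⁺ (Anyₚ.map⁺ (Any.map (λ { refl → in-row }) U∈)))
    where
    in-row : fibreSize S U h ∈ (if ⌊ size U ℕ.≟ j ⌋ then map (fibreSize S U) (allFuns k elems) else [])
    in-row with size U ℕ.≟ j
    ... | yes _ = Memₚ.∈-map⁺ (fibreSize S U) h∈
    ... | no ne = ⊥-elim (ne e)

  alpha-≤ : ∀ (S₁ S₂ : (Fin k → G) → Bool) j D →
    (∀ U → size U ≡ j → ∀ {h} → h ∈ allFuns k elems → ∃ λ h′ → h′ ∈ allFuns k elems × fibreSize S₁ U h ≤ D * fibreSize S₂ U h′) →
    alpha k elems eqG S₁ j ≤ D * alpha k elems eqG S₂ j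
  alpha-≤ S₁ S₂ j D dominated = maxList-lub _ (Allₚ.concat⁺ (Allₚ.map⁺ (All.tabulate bounded)))
    where
    bounded : ∀ {U} → U ∈ allFuns k (true ∷ false ∷ []) →
      All (_≤ D * alpha k elems eqG S₂ j) (if ⌊ size U ℕ.≟ j ⌋ then map (fibreSize S₁ U) (allFuns k elems) else [])
    bounded {U} U∈ with size U ℕ.≟ j
    ... | no _ = []
    ... | yes e = Allₚ.map⁺ (All.tabulate (λ h∈ → let h′ , h′∈ , le = dominated U e h∈ in
                    ℕₚ.≤-trans le (ℕₚ.*-monoʳ-≤ D (fibreSize-≤-alpha S₂ j U∈ e h′∈))))

module _ {k m n : ℕ} {U : Fin k → Bool} {h s : Fin k → Fin m → Fin n} where

  agrees⁻ : T (agrees eqVec U h s) → ∀ i → T (U i) → ∀ a → h i a ≡ s i a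
  agrees⁻ t i Ui a = toWitness (allᶠ⁻ m (implied (U i) (allᶠ⁻ k t i) Ui) a)
    where
    implied : ∀ u {e} → T (not u ∨ e) → T u → T e
    implied true t _ = t

  agrees⁺ : (∀ i → T (U i) → ∀ a → h i a ≡ s i a) → T (agrees eqVec U h s)
  agrees⁺ agree = allᶠ⁺ k (λ i → implies (U i) (λ Ui → allᶠ⁺ m (λ a → fromWitness (agree i Ui a))))
    where
    implies : ∀ u {e} → (T u → T e) → T (not u ∨ e)
    implies true f = f tt
    implies false _ = tt

∑-cong : ∀ n {f g : Fin n → ℤ} → (∀ i → f i ≡ g i) → ∑ n f ≡ ∑ n g
∑-cong zero h = refl
∑-cong (suc n) h = ≡.cong₂ ℤ._+_ (h Fin.zero) (∑-cong n (h ∘ Fin.suc))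

∑-distrib-+ : ∀ n (f g : Fin n → ℤ) → ∑ n (λ i → f i ℤ.+ g i) ≡ ∑ n f ℤ.+ ∑ n g
∑-distrib-+ zero f g = refl
∑-distrib-+ (suc n) f g = ≡.trans (cong (λ s → (f Fin.zero ℤ.+ g Fin.zero) ℤ.+ s) (∑-distrib-+ n (f ∘ Fin.suc) (g ∘ Fin.suc)))
  (+-interchange (f Fin.zero) (g Fin.zero) (∑ n (f ∘ Fin.suc)) (∑ n (g ∘ Fin.suc)))

∣∑∣≤ : ∀ n {f : Fin n → ℤ} {c} → (∀ i → ∣ f i ∣ ≤ c) → ∣ ∑ n f ∣ ≤ n * c
∣∑∣≤ zero h = z≤n
∣∑∣≤ (suc n) {f} h = ℕₚ.≤-trans (ℤₚ.∣i+j∣≤∣i∣+∣j∣ (f Fin.zero) _) (ℕₚ.+-mono-≤ (h Fin.zero) (∣∑∣≤ n (h ∘ Fin.suc)))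

maxᶠ : (n : ℕ) → (Fin n → ℕ) → ℕ
maxᶠ zero f = 0
maxᶠ (suc n) f = f Fin.zero ⊔ maxᶠ n (f ∘ Fin.suc)

≤-maxᶠ : ∀ n (f : Fin n → ℕ) i → f i ≤ maxᶠ n f
≤-maxᶠ (suc n) f Fin.zero = ℕₚ.m≤m⊔n _ _
≤-maxᶠ (suc n) f (Fin.suc i) = ℕₚ.≤-trans (≤-maxᶠ n (f ∘ Fin.suc) i) (ℕₚ.m≤n⊔m _ _)

module _ {m k : ℕ} (M : Mat m k) where

  apply-cong : ∀ {x y : Fin k → Fin m → ℤ} → (∀ i a → x i a ≡ y i a) → ∀ i a → apply M x i a ≡ apply M y i a
  apply-cong x≡y i a = ∑-cong k (λ i′ → ∑-cong m (λ a′ → cong (M i a i′ a′ ℤ.*_) (x≡y i′ a′)))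

  apply-+ : ∀ (x y : Fin k → Fin m → ℤ) i a →
    apply M (λ i a → x i a ℤ.+ y i a) i a ≡ apply M x i a ℤ.+ apply M y i a
  apply-+ x y i a = ≡.trans
    (∑-cong k (λ i′ → ≡.trans (∑-cong m (λ a′ → ℤₚ.*-distribˡ-+ (M i a i′ a′) (x i′ a′) (y i′ a′))) (∑-distrib-+ m _ _)))
    (∑-distrib-+ k _ _)

  apply-translate : Invariant M → ∀ (x : Fin k → Fin m → ℤ) (d : Fin m → ℤ) i a →
    apply M (λ i a → x i a ℤ.+ d a) i a ≡ apply M x i a
  apply-translate invariant x d i a = ≡.trans (apply-+ x (λ _ → d) i a)
    (≡.trans (cong (λ s → apply M x i a ℤ.+ s) (invariant d i a)) (ℤₚ.+-identityʳ _))

  entryBound : ℕ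
  entryBound = maxᶠ k λ i → maxᶠ m λ a → maxᶠ k λ i′ → maxᶠ m λ a′ → ∣ M i a i′ a′ ∣

  ∣entry∣≤entryBound : ∀ i a i′ a′ → ∣ M i a i′ a′ ∣ ≤ entryBound
  ∣entry∣≤entryBound i a i′ a′ =
    ℕₚ.≤-trans (≤-maxᶠ m _ a′) (ℕₚ.≤-trans (≤-maxᶠ k _ i′) (ℕₚ.≤-trans (≤-maxᶠ m _ a) (≤-maxᶠ k _ i)))

  rowBound : ℕ
  rowBound = k * (m * entryBound)

  ∣apply∣≤ : ∀ {x : Fin k → Fin m → ℤ} {c} → (∀ i a → ∣ x i a ∣ ≤ c) → ∀ i a → ∣ apply M x i a ∣ ≤ rowBound * c
  ∣apply∣≤ {x} {c} x≤ i a = begin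
    ∣ apply M x i a ∣             ≤⟨ ∣∑∣≤ k (λ i′ → ∣∑∣≤ m (λ a′ → entry-term≤ i′ a′)) ⟩
    k * (m * (entryBound * c))    ≡⟨ cong (k *_) (ℕₚ.*-assoc m entryBound c) ⟨
    k * (m * entryBound * c)      ≡⟨ ℕₚ.*-assoc k (m * entryBound) c ⟨
    rowBound * c                  ∎
    where
    open ℕₚ.≤-Reasoning
    entry-term≤ : ∀ i′ a′ → ∣ M i a i′ a′ ℤ.* x i′ a′ ∣ ≤ entryBound * c
    entry-term≤ i′ a′ = ℕₚ.≤-trans (ℕₚ.≤-reflexive (ℤₚ.abs-* (M i a i′ a′) (x i′ a′)))
                                    (ℕₚ.*-mono-≤ (∣entry∣≤entryBound i a i′ a′) (x≤ i′ a′))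

≡-from-sign-quotient : ∀ {n} .{{_ : NonZero n}} {v w : ℤ} → n ∣ ∣ v ∣ → n ∣ ∣ w ∣ →
  sign v ≡ sign w → ∣ v ∣ / n ≡ ∣ w ∣ / n → v ≡ w
≡-from-sign-quotient {n} {v} {w} n∣v n∣w sign≡ quotient≡ = begin
  v                 ≡⟨ ≡.sym (ℤₚ.◃-inverse v) ⟩
  sign v ◃ ∣ v ∣    ≡⟨ ≡.cong₂ _◃_ sign≡ ∣v∣≡∣w∣ ⟩
  sign w ◃ ∣ w ∣    ≡⟨ ℤₚ.◃-inverse w ⟩
  w                 ∎
  where
  open ≡.≡-Reasoning
  ∣v∣≡∣w∣ : ∣ v ∣ ≡ ∣ w ∣
  ∣v∣≡∣w∣ = ≡.trans (≡.sym (m/n*n≡m n∣v)) (≡.trans (cong (_* n) quotient≡) (m/n*n≡m n∣w))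

same-side : ∀ {t x r} → ⌊ x <? t ⌋ ≡ ⌊ r <? t ⌋ → (x < t × r < t) ⊎ (t ≤ x × t ≤ r)
same-side {t} {x} {r} e with x <? t | r <? t
... | yes x<t | yes r<t = inj₁ (x<t , r<t)
... | no x≮t | no r≮t = inj₂ (ℕₚ.≮⇒≥ x≮t , ℕₚ.≮⇒≥ r≮t)

-- Both halves of [0,n) have length at most ⌈n/2⌉ and ⌊n/2⌋ + ⌈n/2⌉ = n, so shifting the difference
-- x − r of two points in the same half by ⌊n/2⌋ lands in [0,n).
shift-in-range : ∀ {n x r} → x < n → r < n → (x < ⌈ n /2⌉ × r < ⌈ n /2⌉) ⊎ (⌈ n /2⌉ ≤ x × ⌈ n /2⌉ ≤ r) →
  r ≤ ⌊ n /2⌋ + x × ⌊ n /2⌋ + x < r + n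
shift-in-range {n} {x} {r} x<n r<n (inj₁ (x<t , r<t)) = r≤ , <r+n
  where
  open ℕₚ.≤-Reasoning
  r≤ : r ≤ ⌊ n /2⌋ + x
  r≤ = begin
    r              ≤⟨ ℕ.s≤s⁻¹ (ℕₚ.<-≤-trans r<t (ℕₚ.⌊n/2⌋-mono (ℕₚ.n≤1+n (suc n)))) ⟩
    ⌊ n /2⌋        ≤⟨ ℕₚ.m≤m+n ⌊ n /2⌋ x ⟩
    ⌊ n /2⌋ + x    ∎
  <r+n : ⌊ n /2⌋ + x < r + n
  <r+n = begin-strict
    ⌊ n /2⌋ + x         <⟨ ℕₚ.+-monoʳ-< ⌊ n /2⌋ x<t ⟩
    ⌊ n /2⌋ + ⌈ n /2⌉   ≡⟨ ℕₚ.⌊n/2⌋+⌈n/2⌉≡n n ⟩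
    n                   ≤⟨ ℕₚ.m≤n+m n r ⟩
    r + n               ∎
shift-in-range {n} {x} {r} x<n r<n (inj₂ (t≤x , t≤r)) = ℕₚ.<⇒≤ r< , <r+n
  where
  open ℕₚ.≤-Reasoning
  r< : r < ⌊ n /2⌋ + x
  r< = begin-strict
    r                   <⟨ r<n ⟩
    n                   ≡⟨ ℕₚ.⌊n/2⌋+⌈n/2⌉≡n n ⟨
    ⌊ n /2⌋ + ⌈ n /2⌉   ≤⟨ ℕₚ.+-monoʳ-≤ ⌊ n /2⌋ t≤x ⟩
    ⌊ n /2⌋ + x         ∎
  <r+n : ⌊ n /2⌋ + x < r + n
  <r+n = ℕₚ.+-mono-≤-< (ℕₚ.≤-trans (ℕₚ.⌊n/2⌋≤⌈n/2⌉ n) t≤r) x<n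

⌊n/2⌋<n : ∀ n .{{_ : NonZero n}} → ⌊ n /2⌋ < n
⌊n/2⌋<n (suc n) = ℕₚ.⌊n/2⌋<n n

module _ (n : ℕ) .{{_ : NonZero n}} where

  toℕ-mod : ∀ {w} → w < n → toℕ (w mod n) ≡ w
  toℕ-mod w<n = ≡.trans (Finₚ.toℕ-fromℕ< _) (m<n⇒m%n≡m w<n)

  lowerHalf : Fin n → Bool
  lowerHalf x = ⌊ toℕ x <? ⌈ n /2⌉ ⌋

  shiftFin : Fin n → Fin n → Fin n
  shiftFin r x = ((⌊ n /2⌋ + toℕ x) ∸ toℕ r) mod n

  toℕ-shiftFin : ∀ {r x} → lowerHalf x ≡ lowerHalf r → toℕ (shiftFin r x) + toℕ r ≡ ⌊ n /2⌋ + toℕ x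
  toℕ-shiftFin {r} {x} halves = begin
    toℕ (shiftFin r x) + toℕ r            ≡⟨ cong (_+ toℕ r) (toℕ-mod in-range) ⟩
    (⌊ n /2⌋ + toℕ x) ∸ toℕ r + toℕ r     ≡⟨ ℕₚ.m∸n+n≡m (proj₁ bounds) ⟩
    ⌊ n /2⌋ + toℕ x                       ∎
    where
    open ≡.≡-Reasoning
    bounds : toℕ r ≤ ⌊ n /2⌋ + toℕ x × ⌊ n /2⌋ + toℕ x < toℕ r + n
    bounds = shift-in-range (Finₚ.toℕ<n x) (Finₚ.toℕ<n r) (same-side halves)
    in-range : (⌊ n /2⌋ + toℕ x) ∸ toℕ r < n
    in-range = ℕₚ.m<n+o⇒m∸n<o _ (toℕ r) (proj₂ bounds)

module _ {m k : ℕ} (M : Mat m k) (n : ℕ) {x : Fin k → Fin m → Fin n} where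

  inS⁻ : T (inS M n x) → ∀ i a → apply M (λ i′ → boxToℤ (x i′)) i a ≡ + 0
  inS⁻ t i a = toWitness (allᶠ⁻ m (allᶠ⁻ k t i) a)

  inS⁺ : (∀ i a → apply M (λ i′ → boxToℤ (x i′)) i a ≡ + 0) → T (inS M n x)
  inS⁺ h = allᶠ⁺ k (λ i → allᶠ⁺ m (λ a → fromWitness (h i a)))

  inSbar⁻ : T (inSbar M n x) → ∀ i a → n ∣ ∣ apply M (λ i′ a′ → + toℕ (x i′ a′)) i a ∣
  inSbar⁻ t i a = toWitness (allᶠ⁻ m (allᶠ⁻ k t i) a)

  inSbar⁺ : (∀ i a → n ∣ ∣ apply M (λ i′ a′ → + toℕ (x i′ a′)) i a ∣) → T (inSbar M n x)
  inSbar⁺ h = allᶠ⁺ k (λ i → allᶠ⁺ m (λ a → fromWitness (h i a)))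

module Reduction {m k : ℕ} (M : Mat m k) (invariant : Invariant M) where

  Class : Set
  Class = (Sign × ℕ) × Bool

  classValues : List Class
  classValues = cartesianProduct (cartesianProduct (Sign.+ ∷ Sign.- ∷ []) (upTo (suc (rowBound M)))) (true ∷ false ∷ [])

  ClassPatterns : Setoid 0ℓ 0ℓ
  ClassPatterns = Funs (Funs (≡.setoid Class) m) k

  _≈ᶜ_ : Rel (Fin k → Fin m → Class) 0ℓ
  _≈ᶜ_ = Setoid._≈_ ClassPatterns

  _≟ᶜ_ : Decidable _≈ᶜ_
  _≟ᶜ_ = Pointwiseₚ.decidable (Pointwiseₚ.decidable (×-≡-dec (×-≡-dec Sign._≟_ ℕ._≟_) Bool._≟_))

  classPatterns : List (Fin k → Fin m → Class)
  classPatterns = allFuns k (allFuns m classValues)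

  module _ (n : ℕ) .{{_ : NonZero n}} where

    Tuples : Setoid 0ℓ 0ℓ
    Tuples = Funs (Funs (≡.setoid (Fin n)) m) k

    open Setoid Tuples using (_≈_) renaming (Carrier to Tuple)

    tuples : List Tuple
    tuples = allFuns k (boxElems m n)

    tuples-complete : ∀ x → Any (x ≈_) tuples
    tuples-complete x = allFuns-complete (Funs (≡.setoid (Fin n)) m) k x
      (λ i → allFuns-complete (≡.setoid (Fin n)) m (x i) (λ a → Memₚ.∈-allFin (x i a)))

    tuples-unique : Unique Tuples tuples
    tuples-unique = allFuns-unique (Funs (≡.setoid (Fin n)) m) k (allFuns-unique (≡.setoid (Fin n)) m (allFin⁺ n))

    value : Tuple → Fin k → Fin m → ℤ
    value x = apply M (λ i a → + toℕ (x i a))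

    box≡value : ∀ x i a → apply M (λ i′ → boxToℤ (x i′)) i a ≡ value x i a
    box≡value x i a = ≡.trans
      (apply-cong M (λ i′ a′ → ≡.trans (cong +_ (ℕₚ.+-comm 1 (toℕ (x i′ a′)))) (ℤₚ.pos-+ (toℕ (x i′ a′)) 1)) i a)
      (apply-translate M invariant _ (λ _ → + 1) i a)

    inS⇒inSbar : ∀ {x} → T (inS M n x) → T (inSbar M n x)
    inS⇒inSbar {x} t = inSbar⁺ M n (λ i a → subst (λ v → n ∣ ∣ v ∣) (≡.trans (≡.sym (inS⁻ M n t i a)) (box≡value x i a)) (n ∣0))

    quotient≤ : ∀ x i a → ∣ value x i a ∣ / n ≤ rowBound M
    quotient≤ x i a = ℕₚ.≤-trans (/-monoˡ-≤ n (∣apply∣≤ M (λ i′ a′ → ℕₚ.<⇒≤ (Finₚ.toℕ<n (x i′ a′))) i a))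
                                 (ℕₚ.≤-reflexive (m*n/n≡m (rowBound M) n))

    class : Tuple → Fin k → Fin m → Class
    class x i a = (sign (value x i a) , ∣ value x i a ∣ / n) , lowerHalf n (x i a)

    class-complete : ∀ x → Any (class x ≈ᶜ_) classPatterns
    class-complete x = allFuns-complete (Funs (≡.setoid Class) m) k (class x)
      (λ i → allFuns-complete (≡.setoid Class) m (class x i) (λ a →
        Memₚ.∈-cartesianProduct⁺ (Memₚ.∈-cartesianProduct⁺ (sign∈ _) (Memₚ.∈-upTo⁺ (s≤s (quotient≤ x i a)))) (bool∈ _)))
      where
      sign∈ : ∀ s → s ∈ Sign.+ ∷ Sign.- ∷ []
      sign∈ Sign.+ = here refl
      sign∈ Sign.- = there (here refl)
      bool∈ : ∀ b → b ∈ true ∷ false ∷ []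
      bool∈ true = here refl
      bool∈ false = there (here refl)

    shift : Tuple → Tuple → Tuple
    shift r x i a = shiftFin n (r i a) (x i a)

    module _ {r : Tuple} (r∈S̄ : T (inSbar M n r)) where

      module _ {x : Tuple} (same : class x ≈ᶜ class r) where

        toℕ-shift : ∀ i a → toℕ (shift r x i a) + toℕ (r i a) ≡ ⌊ n /2⌋ + toℕ (x i a)
        toℕ-shift i a = toℕ-shiftFin n (cong proj₂ (same i a))

        shift-inS : T (inSbar M n x) → ∀ {b} → shift r x ≈ b → T (inS M n b)
        shift-inS x∈S̄ {b} shift≈b = inS⁺ M n (λ i a → identityˡ-unique _ (value r i a) (begin
          apply M (λ i′ → boxToℤ (b i′)) i a ℤ.+ value r i a            ≡⟨ apply-+ M _ _ i a ⟨
          apply M (λ i′ a′ → boxToℤ (b i′) a′ ℤ.+ + toℕ (r i′ a′)) i a  ≡⟨ apply-cong M shifted i a ⟩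
          apply M (λ i′ a′ → + toℕ (x i′ a′) ℤ.+ + suc ⌊ n /2⌋) i a     ≡⟨ apply-translate M invariant _ (λ _ → + suc ⌊ n /2⌋) i a ⟩
          value x i a                                                   ≡⟨ same-value i a ⟩
          value r i a                                                   ∎))
          where
          open ≡.≡-Reasoning
          same-value : ∀ i a → value x i a ≡ value r i a
          same-value i a = ≡-from-sign-quotient (inSbar⁻ M n x∈S̄ i a) (inSbar⁻ M n r∈S̄ i a)
            (cong (proj₁ ∘ proj₁) (same i a)) (cong (proj₂ ∘ proj₁) (same i a))
          shifted : ∀ i a → boxToℤ (b i) a ℤ.+ + toℕ (r i a) ≡ + toℕ (x i a) ℤ.+ + suc ⌊ n /2⌋
          shifted i a = ≡.trans (≡.sym (ℤₚ.pos-+ (suc (toℕ (b i a))) _)) (≡.trans (cong +_ (begin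
            suc (toℕ (b i a) + toℕ (r i a))             ≡⟨ cong (λ v → suc (toℕ v + toℕ (r i a))) (shift≈b i a) ⟨
            suc (toℕ (shift r x i a) + toℕ (r i a))     ≡⟨ cong suc (toℕ-shift i a) ⟩
            suc ⌊ n /2⌋ + toℕ (x i a)                   ≡⟨ ℕₚ.+-comm (suc ⌊ n /2⌋) _ ⟩
            toℕ (x i a) + suc ⌊ n /2⌋                   ∎)) (ℤₚ.pos-+ (toℕ (x i a)) (suc ⌊ n /2⌋)))

        shift-agrees : ∀ {U h c} → T (agrees eqVec U h x) → T (agrees eqVec U h r) →
          (∀ i a → toℕ (c i a) ≡ ⌊ n /2⌋) → ∀ {b} → shift r x ≈ b → T (agrees eqVec U c b)
        shift-agrees {U} {h} x-agrees r-agrees c≡ {b} shift≈b = agrees⁺ (λ i Ui a → Finₚ.toℕ-injective (≡.trans (c≡ i a)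
          (ℕₚ.+-cancelʳ-≡ (toℕ (r i a)) _ _ (begin
            ⌊ n /2⌋ + toℕ (r i a)                ≡⟨ cong (λ v → ⌊ n /2⌋ + toℕ v) (≡.trans (≡.sym (agrees⁻ {U = U} {h} r-agrees i Ui a)) (agrees⁻ {U = U} {h} x-agrees i Ui a)) ⟩
            ⌊ n /2⌋ + toℕ (x i a)                ≡⟨ toℕ-shift i a ⟨
            toℕ (shift r x i a) + toℕ (r i a)    ≡⟨ cong (λ v → toℕ v + toℕ (r i a)) (shift≈b i a) ⟩
            toℕ (b i a) + toℕ (r i a)            ∎))))
          where open ≡.≡-Reasoning

      shift-injective : ∀ {x y} → class x ≈ᶜ class r → class y ≈ᶜ class r → shift r x ≈ shift r y → x ≈ y
      shift-injective {x} {y} x∼r y∼r shift≈ i a = Finₚ.toℕ-injective (ℕₚ.+-cancelˡ-≡ ⌊ n /2⌋ _ _ (begin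
        ⌊ n /2⌋ + toℕ (x i a)              ≡⟨ toℕ-shift x∼r i a ⟨
        toℕ (shift r x i a) + toℕ (r i a)  ≡⟨ cong (λ v → toℕ v + toℕ (r i a)) (shift≈ i a) ⟩
        toℕ (shift r y i a) + toℕ (r i a)  ≡⟨ toℕ-shift y∼r i a ⟩
        ⌊ n /2⌋ + toℕ (y i a)              ∎))
        where open ≡.≡-Reasoning

    module Fibres (U : Fin k → Bool) (h c : Tuple) (c-centre : ∀ i a → toℕ (c i a) ≡ ⌊ n /2⌋) where

      inBarFibre inBoxFibre : Tuple → Bool
      inBarFibre s = inSbar M n s ∧ agrees eqVec U h s
      inBoxFibre s = inS M n s ∧ agrees eqVec U c s

      inClass : (Fin k → Fin m → Class) → Tuple → Bool
      inClass κ x = inBarFibre x ∧ ⌊ class x ≟ᶜ κ ⌋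

      inClass⁻ : ∀ {κ x} → T (inClass κ x) → T (inSbar M n x) × T (agrees eqVec U h x) × class x ≈ᶜ κ
      inClass⁻ {x = x} t = let x∈fibre , x∼κ = T-∧⁻ {inBarFibre x} t ; x∈S̄ , x-agrees = T-∧⁻ {inSbar M n x} x∈fibre in
        x∈S̄ , x-agrees , toWitness x∼κ

      module _ {κ} {r : Tuple} (r∈κ : T (inClass κ r)) where

        private
          r∈S̄ : T (inSbar M n r)
          r∈S̄ = proj₁ (inClass⁻ r∈κ)
          same-class : ∀ {x} → T (inClass κ x) → class x ≈ᶜ class r
          same-class x∈κ = let _ , _ , x∼κ = inClass⁻ x∈κ ; _ , _ , r∼κ = inClass⁻ r∈κ in
            Setoid.trans ClassPatterns x∼κ (Setoid.sym ClassPatterns r∼κ)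

        shift-into-boxFibre : ∀ {x} → T (inClass κ x) → Any (λ b → shift r x ≈ b × T (inBoxFibre b)) tuples
        shift-into-boxFibre {x} x∈κ =
          let x∈S̄ , x-agrees , _ = inClass⁻ x∈κ ; _ , r-agrees , _ = inClass⁻ r∈κ in
          Any.map (λ shift≈b → shift≈b , T-∧⁺ (shift-inS r∈S̄ (same-class x∈κ) x∈S̄ shift≈b)
                                              (shift-agrees r∈S̄ (same-class x∈κ) x-agrees r-agrees c-centre shift≈b))
                  (tuples-complete (shift r x))

        shift-injective-on-class : ∀ {x y} → T (inClass κ x) → T (inClass κ y) → shift r x ≈ shift r y → x ≈ y
        shift-injective-on-class x∈κ y∈κ = shift-injective r∈S̄ (same-class x∈κ) (same-class y∈κ)

      count-inClass-≤ : ∀ κ → count (inClass κ) tuples ≤ count inBoxFibre tuples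
      count-inClass-≤ κ = count-≤-if-witnessed (inClass κ) tuples λ {r} _ r∈κ →
        count-≤-injection Tuples Tuples (shift r) (inClass κ) inBoxFibre tuples-unique
          (λ _ → shift-into-boxFibre r∈κ) (λ _ _ → shift-injective-on-class r∈κ)

      fibreSize-inSbar-≤ : fibreSize k (boxElems m n) eqVec (inSbar M n) U h ≤
                           length classPatterns * fibreSize k (boxElems m n) eqVec (inS M n) U c
      fibreSize-inSbar-≤ = count-≤-partition _≟ᶜ_ class inBarFibre classPatterns tuples
        (λ {x} _ _ → class-complete x) count-inClass-≤

    αbox≤αbar : ∀ j → αbox M n j ≤ αbar M n j
    αbox≤αbar j = subst (αbox M n j ≤_) (ℕₚ.*-identityˡ _)
      (alpha-≤ k (boxElems m n) eqVec (inS M n) (inSbar M n) j 1 λ U _ {h} h∈ → h , h∈ , ℕₚ.≤-trans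
        (count-mono {p = λ s → inS M n s ∧ agrees eqVec U h s} {q = λ s → inSbar M n s ∧ agrees eqVec U h s} tuples
          (λ _ t → let x∈S , x-agrees = T-∧⁻ t in T-∧⁺ (inS⇒inSbar x∈S) x-agrees))
        (ℕₚ.≤-reflexive (≡.sym (ℕₚ.*-identityˡ _))))

    αbar≤αbox : ∀ j → αbar M n j ≤ length classPatterns * αbox M n j
    αbar≤αbox j = alpha-≤ k (boxElems m n) eqVec (inSbar M n) (inS M n) j (length classPatterns) λ U _ {h} _ →
      let c , c∈ , centre≈c = find (tuples-complete (λ _ _ → ⌊ n /2⌋ mod n)) in
      c , c∈ , Fibres.fibreSize-inSbar-≤ U h c (λ i a → ≡.trans (cong toℕ (≡.sym (centre≈c i a))) (toℕ-mod n (⌊n/2⌋<n n)))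

  classPatterns-nonempty : 1 ≤ length classPatterns
  classPatterns-nonempty = nonempty (class-complete 1 (λ _ _ → Fin.zero))
    where
    nonempty : ∀ {P : (Fin k → Fin m → Class) → Set} {xs} → Any P xs → 1 ≤ length xs
    nonempty (here _) = s≤s z≤n
    nonempty (there _) = s≤s z≤n

toℚ≡mkℚ : ∀ a → toℚ a ≡ mkℚ (+ a) 0 (Coprimality.sym (Coprimality.1-coprimeTo a))
toℚ≡mkℚ a = ℚₚ.normalize-coprime _

toℚ-mono : ∀ {a b} → a ≤ b → toℚ a ℚ.≤ toℚ b
toℚ-mono {a} {b} a≤b rewrite toℚ≡mkℚ a | toℚ≡mkℚ b =
  ℚ.*≤* (subst₂ ℤ._≤_ (≡.sym (ℤₚ.*-identityʳ (+ a))) (≡.sym (ℤₚ.*-identityʳ (+ b))) (ℤ.+≤+ a≤b))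

toℚ-pos : ∀ {a} → 1 ≤ a → 0ℚ ℚ.< toℚ a
toℚ-pos {a} 1≤a rewrite toℚ≡mkℚ a = ℚ.*<* (subst (ℤ._<_ (+ 0)) (≡.sym (ℤₚ.*-identityʳ (+ a))) (ℤ.+<+ 1≤a))

toℚ-* : ∀ a b → toℚ a ℚ.* toℚ b ≡ toℚ (a * b)
toℚ-* a b rewrite toℚ≡mkℚ a | toℚ≡mkℚ b = cong (ℚ._/ 1) (≡.sym (ℤₚ.pos-* a b))

proposition6p11 : (m k : ℕ) → 1 ≤ m → 1 ≤ k → (M : Mat m k) → Invariant M →
    (γ : ℚ → ℚ) → VProperty M γ →
    Σ ℕ (λ lam → 1 ≤ lam × Σ ℚ (λ c → 0ℚ ℚ.< c ×
      (∀ (n j : ℕ) → 1 ≤ n → 1 ≤ j → j ≤ k →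
        αbox M n j ≤ αbar M (lam * n) j ×
        toℚ (αbar M (lam * n) j) ℚ.≤ c ℚ.* toℚ (αbox M n j))))
proposition6p11 m k _ _ M invariant _ _ = 1 , ℕₚ.≤-refl , toℚ D , toℚ-pos classPatterns-nonempty , bounds
  where
  open Reduction M invariant
  D : ℕ
  D = length classPatterns
  bounds : ∀ (n j : ℕ) → 1 ≤ n → 1 ≤ j → j ≤ k →
    αbox M n j ≤ αbar M (1 * n) j × toℚ (αbar M (1 * n) j) ℚ.≤ toℚ D ℚ.* toℚ (αbox M n j)
  bounds n j 1≤n _ _ = subst (λ N → αbox M n j ≤ αbar M N j × toℚ (αbar M N j) ℚ.≤ toℚ D ℚ.* toℚ (αbox M n j))
    (≡.sym (ℕₚ.*-identityˡ n))
    (αbox≤αbar n {{ℕ.>-nonZero 1≤n}} j ,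
     subst (toℚ (αbar M n j) ℚ.≤_) (≡.sym (toℚ-* D (αbox M n j))) (toℚ-mono (αbar≤αbox n {{ℕ.>-nonZero 1≤n}} j)))
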